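{- For every integer $r\ge 1$ and every even integer $s\ge 2$, $\chi_{la}(DF_r(2s))=3$, where $DF_r(2s)=rDF(2s)+FB(s)$.
   Context: For a graph $G=(V,E)$ with $|E|=m$ and no isolated vertices, a local antimagic labeling is a bijection $f:E\to\{1,\dots,m\}$ such that $f^+(u)\ne f^+(v)$ for every edge $uv$, where $f^+(x)=\sum f(e)$ over all edges $e$ incident to $x$. The local antimagic chromatic number $\chi_{la}(G)$ is the minimum, over all local antimagic labelings $f$ of $G$, of the number of distinct values taken by $f^+$ (also for disconnected graphs). $G+H$ is the disjoint union and $rG$ the disjoint union of $r$ copies of $G$. The fan graph with $n$ blades is $FB(n)=nP_3\vee K_1$. For $s\ge 1$, let $S_1,S_2$ be two disjoint copies of $sP_3$. The diamond fan $DF(2s)$ is obtained from $S_1+S_2$ by adding a vertex $y$ adjacent to every degree-1 vertex of $S_1$ and every degree-2 vertex of $S_2$, and a vertex $z$ adjacent to every degree-1 vertex of $S_2$ and every degree-2 vertex of $S_1$. -}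

module Defs where

open import Data.Nat using (ℕ; zero; suc; _+_; _≤_)
open import Data.Nat.Properties using () renaming (_≟_ to _≟ℕ_)
open import Data.Fin using (Fin; toℕ; zero; suc)
open import Data.Fin.Properties using () renaming (_≟_ to _≟F_)
open import Data.Nat.ListAction using (sum)
open import Data.List using (List; []; _∷_; length; map; concatMap; upTo; allFin; lookup; deduplicate; _++_)
open import Data.Product using (_×_; _,_; proj₁; proj₂; ∃)
open import Data.Bool using (Bool; true; false; if_then_else_; _∨_)
open import Relation.Nullary using (Dec; yes; no; ¬_; ⌊_⌋)
open import Relation.Binary.PropositionalEquality using (_≡_; refl; _≢_; cong)
open import Function.Bundles using (_⤖_; Bijection)

data Vtx : Set where
  -- copy c of DF(2s); i = 0 for S₁, i = 1 for S₂; j-th copy of P₃;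
  -- position p ∈ {0,1,2} along the path (p = 1 is the middle, degree-2 vertex)
  dfP : (c : ℕ) → (i : Fin 2) → (j : ℕ) → (p : Fin 3) → Vtx
  dfY : (c : ℕ) → Vtx
  dfZ : (c : ℕ) → Vtx
  -- fan FB(s) = s P₃ ∨ K₁ : j-th P₃, position p; and the apex
  fbP : (j : ℕ) → (p : Fin 3) → Vtx
  fbC : Vtx

_≟V_ : (u v : Vtx) → Dec (u ≡ v)
dfP c i j p ≟V dfP c' i' j' p' with c ≟ℕ c' | i ≟F i' | j ≟ℕ j' | p ≟F p'
... | yes refl | yes refl | yes refl | yes refl = yes refl
... | no ne | _ | _ | _ = no λ { refl → ne refl }
... | yes _ | no ne | _ | _ = no λ { refl → ne refl }
... | yes _ | yes _ | no ne | _ = no λ { refl → ne refl }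
... | yes _ | yes _ | yes _ | no ne = no λ { refl → ne refl }
dfY c ≟V dfY c' with c ≟ℕ c'
... | yes refl = yes refl
... | no ne = no λ { refl → ne refl }
dfZ c ≟V dfZ c' with c ≟ℕ c'
... | yes refl = yes refl
... | no ne = no λ { refl → ne refl }
fbP j p ≟V fbP j' p' with j ≟ℕ j' | p ≟F p'
... | yes refl | yes refl = yes refl
... | no ne | _ = no λ { refl → ne refl }
... | yes _ | no ne = no λ { refl → ne refl }
fbC ≟V fbC = yes refl
dfP _ _ _ _ ≟V dfY _ = no λ ()
dfP _ _ _ _ ≟V dfZ _ = no λ ()
dfP _ _ _ _ ≟V fbP _ _ = no λ ()
dfP _ _ _ _ ≟V fbC = no λ ()
dfY _ ≟V dfP _ _ _ _ = no λ ()
dfY _ ≟V dfZ _ = no λ ()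
dfY _ ≟V fbP _ _ = no λ ()
dfY _ ≟V fbC = no λ ()
dfZ _ ≟V dfP _ _ _ _ = no λ ()
dfZ _ ≟V dfY _ = no λ ()
dfZ _ ≟V fbP _ _ = no λ ()
dfZ _ ≟V fbC = no λ ()
fbP _ _ ≟V dfP _ _ _ _ = no λ ()
fbP _ _ ≟V dfY _ = no λ ()
fbP _ _ ≟V dfZ _ = no λ ()
fbP _ _ ≟V fbC = no λ ()
fbC ≟V dfP _ _ _ _ = no λ ()
fbC ≟V dfY _ = no λ ()
fbC ≟V dfZ _ = no λ ()
fbC ≟V fbP _ _ = no λ ()

-- A graph without isolated vertices is given by its list of edges;
-- its vertex set is the set of endpoints of the edges.

Graph : Set
Graph = List (Vtx × Vtx)

vertices : Graph → List Vtx
vertices E = concatMap (λ e → proj₁ e ∷ proj₂ e ∷ []) E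

Labeling : Graph → Set
Labeling E = Fin (length E) ⤖ Fin (length E)

label : (E : Graph) → Labeling E → Fin (length E) → ℕ
label E f k = suc (toℕ (Bijection.to f k))

incident : Vtx → Vtx × Vtx → Bool
incident x e = ⌊ x ≟V proj₁ e ⌋ ∨ ⌊ x ≟V proj₂ e ⌋

vsum : (E : Graph) → Labeling E → Vtx → ℕ
vsum E f x = sum (map (λ k → if incident x (lookup E k) then label E f k else 0) (allFin (length E)))

IsLocalAntimagic : (E : Graph) → Labeling E → Set
IsLocalAntimagic E f = (k : Fin (length E)) →
  vsum E f (proj₁ (lookup E k)) ≢ vsum E f (proj₂ (lookup E k))

colours : (E : Graph) → Labeling E → ℕ
colours E f = length (deduplicate _≟ℕ_ (map (vsum E f) (vertices E)))

χla≡ : Graph → ℕ → Set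
χla≡ E k = (∃ λ (f : Labeling E) → IsLocalAntimagic E f × colours E f ≡ k)
         × ((f : Labeling E) → IsLocalAntimagic E f → k ≤ colours E f)

p0 p1 p2 : Fin 3
p0 = zero
p1 = suc zero
p2 = suc (suc zero)

S₁ S₂ : Fin 2
S₁ = zero
S₂ = suc zero

DF : (s c : ℕ) → Graph
DF s c = concatMap blade (upTo s)
  where
  blade : ℕ → List (Vtx × Vtx)
  blade j =
    (dfP c S₁ j p0 , dfP c S₁ j p1) ∷ (dfP c S₁ j p1 , dfP c S₁ j p2) ∷
    (dfP c S₂ j p0 , dfP c S₂ j p1) ∷ (dfP c S₂ j p1 , dfP c S₂ j p2) ∷
    (dfY c , dfP c S₁ j p0) ∷ (dfY c , dfP c S₁ j p2) ∷ (dfY c , dfP c S₂ j p1) ∷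
    (dfZ c , dfP c S₂ j p0) ∷ (dfZ c , dfP c S₂ j p2) ∷ (dfZ c , dfP c S₁ j p1) ∷ []

FB : ℕ → Graph
FB s = concatMap blade (upTo s)
  where
  blade : ℕ → List (Vtx × Vtx)
  blade j = (fbP j p0 , fbP j p1) ∷ (fbP j p1 , fbP j p2) ∷
            (fbC , fbP j p0) ∷ (fbC , fbP j p1) ∷ (fbC , fbP j p2) ∷ []

DFr : (r s : ℕ) → Graph
DFr r s = concatMap (DF s) (upTo r) ++ FB s

-- Lower bound: FB(s) contains triangles, and in a local antimagic labeling the three vertex sums
-- of a triangle are pairwise distinct.
--
-- Upper bound: write s = 2t and M = rs + t, so that there are 10M edges. Group them into M units of
-- ten edges: each blade of each copy of DF(2s) (its two P₃'s with their edges to y and z), and each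
-- pair of consecutive blades of FB(s). Unit q gets ten labels that are affine in q and in
-- q̄ = M - 1 - q, all units together using 1, …, 10M. Since q + q̄ is the same for every unit, every
-- end of a P₃ gets the sum 8M + 1 and every middle vertex 15M + 2; the three spokes of a blade at
-- y, and those at z, add up to 19M + 1, and the six spokes of a unit of FB(s) to 2(19M + 1). So y,
-- z and the centre all get s(19M + 1), and the vertex sums realise a proper 3-colouring.

module Submission where

open import Defs
open import Data.Nat using (ℕ; zero; suc; _+_; _*_; _∸_; _≤_; _<_; _<?_; z≤n; s≤s; NonZero; >-nonZero)
import Data.Nat.Properties as ℕ
open import Data.Nat.Divisibility using (_∣_; divides; n∣m*n)
open import Data.Nat.DivMod
  using (_/_; _%_; m%n<n; m<n*o⇒m/o<n; m*n/n≡m; m<n⇒m/n≡0; +-distrib-/-∣ˡ; %-remove-+ˡ; m≡m%n+[m/n]*n)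
open import Data.Nat.ListAction using (sum)
open import Data.Nat.Tactic.RingSolver using (solve-∀)
open import Data.Fin using (Fin; toℕ; fromℕ<; punchOut) renaming (zero to fzero; suc to fsuc)
open import Data.Fin.Patterns using (0F; 1F; 2F; 3F; 4F; 5F; 6F; 7F; 8F; 9F)
import Data.Fin.Properties as Fin
open import Data.List
  using (List; []; _∷_; _++_; length; map; concat; concatMap; upTo; applyUpTo; zipWith; lookup; take; tabulate; allFin; deduplicate)
import Data.List.Properties as List
open import Data.List.Relation.Unary.All as All using (All; []; _∷_)
import Data.List.Relation.Unary.All.Properties as All
open import Data.List.Relation.Unary.Any as Any using (here; there)
open import Data.List.Relation.Unary.Any.Properties using (lookup-index)
open import Data.List.Relation.Unary.AllPairs using ([]; _∷_)
open import Data.List.Relation.Unary.Unique.Propositional using (Unique)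
open import Data.List.Relation.Unary.Unique.DecPropositional.Properties using (deduplicate-!)
open import Data.List.Membership.Propositional using (_∈_)
open import Data.List.Membership.Propositional.Properties
  using (∈-lookup; ∈-map⁺; ∈-concatMap⁺; ∈-deduplicate⁺; ∈-deduplicate⁻; ∈-++⁺ʳ)
open import Data.Product using (_×_; _,_; proj₁; proj₂; ∃; map₁; map₂; uncurry)
open import Data.Bool using (Bool; true; false; if_then_else_; _∨_)
open import Data.Empty using (⊥-elim)
open import Relation.Nullary using (¬_; yes; no; does; ⌊_⌋)
open import Relation.Nullary.Decidable using (dec-true; dec-false; isYes≗does; does-⇔; from-yes)
open import Relation.Binary.Definitions using (DecidableEquality)
open import Relation.Binary.PropositionalEquality
open import Function using (_∘_)
open import Function.Bundles using (mk⤖; mk⇔)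
open import Function.Definitions using (Injective; Surjective)

private
  variable
    A B C : Set

applyUpTo-cong : ∀ {f g : ℕ → A} n → (∀ i → i < n → f i ≡ g i) → applyUpTo f n ≡ applyUpTo g n
applyUpTo-cong zero    f≗g = refl
applyUpTo-cong (suc n) f≗g = cong₂ _∷_ (f≗g 0 (s≤s z≤n)) (applyUpTo-cong n (λ i i<n → f≗g (suc i) (s≤s i<n)))

applyUpTo-+ : ∀ (f : ℕ → A) m n → applyUpTo f (m + n) ≡ applyUpTo f m ++ applyUpTo (λ i → f (m + i)) n
applyUpTo-+ f zero    n = refl
applyUpTo-+ f (suc m) n = cong (f 0 ∷_) (applyUpTo-+ (f ∘ suc) m n)

applyUpTo-* : ∀ (f : ℕ → A) n w →
              applyUpTo f (n * w) ≡ concat (applyUpTo (λ i → applyUpTo (λ u → f (i * w + u)) w) n)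
applyUpTo-* f zero    w = refl
applyUpTo-* f (suc n) w = begin
  applyUpTo f (w + n * w)
    ≡⟨ applyUpTo-+ f w (n * w) ⟩
  applyUpTo f w ++ applyUpTo (λ i → f (w + i)) (n * w)
    ≡⟨ cong (applyUpTo f w ++_) (applyUpTo-* (λ i → f (w + i)) n w) ⟩
  applyUpTo f w ++ concat (applyUpTo (λ i → applyUpTo (λ u → f (w + (i * w + u))) w) n)
    ≡⟨ cong (λ xss → applyUpTo f w ++ concat xss) (applyUpTo-cong n (λ i _ →
         applyUpTo-cong w (λ u _ → cong f (sym (ℕ.+-assoc w (i * w) u))))) ⟩
  applyUpTo f w ++ concat (applyUpTo (λ i → applyUpTo (λ u → f (suc i * w + u)) w) n)
    ∎
  where open ≡-Reasoning

concat-applyUpTo-* : ∀ (g : ℕ → List A) n w →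
                     concat (applyUpTo g (n * w)) ≡ concat (applyUpTo (λ i → concat (applyUpTo (λ u → g (i * w + u)) w)) n)
concat-applyUpTo-* g n w = begin
  concat (applyUpTo g (n * w))
    ≡⟨ cong concat (applyUpTo-* g n w) ⟩
  concat (concat (applyUpTo (λ i → applyUpTo (λ u → g (i * w + u)) w) n))
    ≡⟨ sym (List.concat-concat (applyUpTo (λ i → applyUpTo (λ u → g (i * w + u)) w) n)) ⟩
  concat (map concat (applyUpTo (λ i → applyUpTo (λ u → g (i * w + u)) w) n))
    ≡⟨ cong concat (List.map-applyUpTo _ concat n) ⟩
  concat (applyUpTo (λ i → concat (applyUpTo (λ u → g (i * w + u)) w)) n)
    ∎
  where open ≡-Reasoning

length-concat-applyUpTo : ∀ (G : ℕ → List A) n {w} → (∀ i → length (G i) ≡ w) →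
                          length (concat (applyUpTo G n)) ≡ n * w
length-concat-applyUpTo G zero    len = refl
length-concat-applyUpTo G (suc n) len =
  trans (List.length-++ (G 0)) (cong₂ _+_ (len 0) (length-concat-applyUpTo (G ∘ suc) n (len ∘ suc)))

tabulate-lookup-zipWith : ∀ (F : A → B → C) (xs : List A) (h : ℕ → B) →
                          tabulate (λ k → F (lookup xs k) (h (toℕ k))) ≡ zipWith F xs (applyUpTo h (length xs))
tabulate-lookup-zipWith F []       h = refl
tabulate-lookup-zipWith F (x ∷ xs) h = cong (F x (h 0) ∷_) (tabulate-lookup-zipWith F xs (h ∘ suc))

module _ (F : A → B → ℕ) where

  sum-zipWith-++ : ∀ (xs xs′ : List A) (ys ys′ : List B) → length xs ≡ length ys →
                   sum (zipWith F (xs ++ xs′) (ys ++ ys′)) ≡ sum (zipWith F xs ys) + sum (zipWith F xs′ ys′)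
  sum-zipWith-++ []       xs′ []       ys′ _   = refl
  sum-zipWith-++ (x ∷ xs) xs′ (y ∷ ys) ys′ len =
    trans (cong (F x y +_) (sum-zipWith-++ xs xs′ ys ys′ (ℕ.suc-injective len))) (sym (ℕ.+-assoc (F x y) _ _))

  sum-zipWith-concat : ∀ (G : ℕ → List A) (H : ℕ → List B) n → (∀ i → length (G i) ≡ length (H i)) →
                       sum (zipWith F (concat (applyUpTo G n)) (concat (applyUpTo H n)))
                         ≡ sum (applyUpTo (λ i → sum (zipWith F (G i) (H i))) n)
  sum-zipWith-concat G H zero    len = refl
  sum-zipWith-concat G H (suc n) len =
    trans (sum-zipWith-++ (G 0) _ (H 0) _ (len 0)) (cong (_ +_) (sum-zipWith-concat (G ∘ suc) (H ∘ suc) n (len ∘ suc)))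

  sum-zipWith-blocks : ∀ (G : ℕ → List A) (h : ℕ → B) n w → (∀ i → length (G i) ≡ w) →
                       sum (zipWith F (concat (applyUpTo G n)) (applyUpTo h (n * w)))
                         ≡ sum (applyUpTo (λ i → sum (zipWith F (G i) (applyUpTo (λ u → h (i * w + u)) w))) n)
  sum-zipWith-blocks G h n w len =
    trans (cong (sum ∘ zipWith F (concat (applyUpTo G n))) (applyUpTo-* h n w))
          (sum-zipWith-concat G _ n (λ i → trans (len i) (sym (List.length-applyUpTo _ w))))

sum-applyUpTo-const : ∀ {g : ℕ → ℕ} n k → (∀ i → i < n → g i ≡ k) → sum (applyUpTo g n) ≡ n * k
sum-applyUpTo-const zero    k g≡k = refl
sum-applyUpTo-const (suc n) k g≡k =
  cong₂ _+_ (g≡k 0 (s≤s z≤n)) (sum-applyUpTo-const n k (λ i i<n → g≡k (suc i) (s≤s i<n)))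

sum-applyUpTo-zero : ∀ {g : ℕ → ℕ} n → (∀ i → i < n → g i ≡ 0) → sum (applyUpTo g n) ≡ 0
sum-applyUpTo-zero n g≡0 = trans (sum-applyUpTo-const n 0 g≡0) (ℕ.*-zeroʳ n)

sum-applyUpTo-single : ∀ {g : ℕ → ℕ} n i₀ → i₀ < n → (∀ i → i < n → i ≢ i₀ → g i ≡ 0) →
                       sum (applyUpTo g n) ≡ g i₀
sum-applyUpTo-single {g} (suc n) zero _ g≡0 =
  trans (cong (g 0 +_) (sum-applyUpTo-zero n (λ i i<n → g≡0 (suc i) (s≤s i<n) λ ()))) (ℕ.+-identityʳ (g 0))
sum-applyUpTo-single {g} (suc n) (suc i₀) (s≤s i₀<n) g≡0 =
  trans (cong (_+ sum (applyUpTo (g ∘ suc) n)) (g≡0 0 (s≤s z≤n) λ ()))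
        (sum-applyUpTo-single n i₀ i₀<n (λ i i<n i≢i₀ → g≡0 (suc i) (s≤s i<n) (i≢i₀ ∘ ℕ.suc-injective)))

module _ {n : ℕ} .{{_ : NonZero n}} where

  [q*n+u]/n≡q : ∀ q {u} → u < n → (q * n + u) / n ≡ q
  [q*n+u]/n≡q q {u} u<n = begin
    (q * n + u) / n     ≡⟨ +-distrib-/-∣ˡ u (n∣m*n q) ⟩
    q * n / n + u / n   ≡⟨ cong₂ _+_ (m*n/n≡m q n) (m<n⇒m/n≡0 u<n) ⟩
    q + 0               ≡⟨ ℕ.+-identityʳ q ⟩
    q                   ∎
    where open ≡-Reasoning

  [q*n+u]%n≡u%n : ∀ q u → (q * n + u) % n ≡ u % n
  [q*n+u]%n≡u%n q u = %-remove-+ˡ u (n∣m*n q)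

  %-/-injective : ∀ {i j} → i % n ≡ j % n → i / n ≡ j / n → i ≡ j
  %-/-injective {i} {j} i%≡ i/≡ = begin
    i                   ≡⟨ m≡m%n+[m/n]*n i n ⟩
    i % n + i / n * n   ≡⟨ cong₂ (λ a b → a + b * n) i%≡ i/≡ ⟩
    j % n + j / n * n   ≡⟨ m≡m%n+[m/n]*n j n ⟨
    j                   ∎
    where open ≡-Reasoning

injective⇒surjective : ∀ {n} {f : Fin n → Fin n} → Injective _≡_ _≡_ f → Surjective _≡_ _≡_ f
injective⇒surjective {suc n} {f} f-inj y with Fin.any? (λ x → f x Fin.≟ y)
... | yes (x , fx≡y) = x , λ { refl → fx≡y }
... | no  y∉img      = ⊥-elim (ℕ.1+n≰n (Fin.injective⇒≤ punchOut∘f-injective))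
  where
  y≢f : ∀ x → y ≢ f x
  y≢f x y≡fx = y∉img (x , sym y≡fx)
  punchOut∘f-injective : Injective _≡_ _≡_ (λ x → punchOut (y≢f x))
  punchOut∘f-injective e = f-inj (Fin.punchOut-injective (y≢f _) (y≢f _) e)

mapEdge : {A : Set} → (A → Vtx) → A × A → Vtx × Vtx
mapEdge φ (a , b) = φ a , φ b

contribution : Vtx → Vtx × Vtx → ℕ → ℕ
contribution x e ℓ = if incident x e then ℓ else 0

module _ (E : Graph) (σ : ℕ → ℕ) where

  private
    n = length E

  permutation⇒labeling : (∀ {k} → k < n → σ k < n) → (∀ {i j} → i < n → j < n → σ i ≡ σ j → i ≡ j) →
                         ∃ λ (f : Labeling E) → ∀ k → label E f k ≡ suc (σ (toℕ k))
  permutation⇒labeling σ< σ-inj =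
    mk⤖ (f-inj , injective⇒surjective f-inj) , λ k → cong suc (Fin.toℕ-fromℕ< (σ< (Fin.toℕ<n k)))
    where
    f : Fin n → Fin n
    f k = fromℕ< (σ< (Fin.toℕ<n k))
    f-inj : Injective _≡_ _≡_ f
    f-inj {i} {j} fi≡fj = Fin.toℕ-injective (σ-inj (Fin.toℕ<n i) (Fin.toℕ<n j)
      (trans (sym (Fin.toℕ-fromℕ< _)) (trans (cong toℕ fi≡fj) (Fin.toℕ-fromℕ< _))))

  vsum-zipWith : (f : Labeling E) → (∀ k → label E f k ≡ suc (σ (toℕ k))) →
                 ∀ x → vsum E f x ≡ sum (zipWith (contribution x) E (applyUpTo (suc ∘ σ) n))
  vsum-zipWith f label≡ x = cong sum (begin
    map (λ k → contribution x (lookup E k) (label E f k)) (allFin n)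
      ≡⟨ List.map-tabulate (λ k → k) _ ⟩
    tabulate (λ k → contribution x (lookup E k) (label E f k))
      ≡⟨ List.tabulate-cong (λ k → cong (contribution x (lookup E k)) (label≡ k)) ⟩
    tabulate (λ k → contribution x (lookup E k) (suc (σ (toℕ k))))
      ≡⟨ tabulate-lookup-zipWith (contribution x) E (suc ∘ σ) ⟩
    zipWith (contribution x) E (applyUpTo (suc ∘ σ) n)
      ∎)
    where open ≡-Reasoning

unique-lookup-injective : ∀ {xs : List ℕ} → Unique xs → Injective _≡_ _≡_ (lookup xs)
unique-lookup-injective {_ ∷ _}  (_ ∷ _)   {fzero}  {fzero}  _ = refl
unique-lookup-injective {_ ∷ xs} (x∉ ∷ _)  {fzero}  {fsuc j} e = ⊥-elim (All.lookup x∉ (∈-lookup {xs = xs} j) e)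
unique-lookup-injective {_ ∷ xs} (x∉ ∷ _)  {fsuc i} {fzero}  e = ⊥-elim (All.lookup x∉ (∈-lookup {xs = xs} i) (sym e))
unique-lookup-injective {_ ∷ _}  (_ ∷ xs!) {fsuc i} {fsuc j} e = cong fsuc (unique-lookup-injective xs! e)

unique-⊆⇒length≤ : ∀ {xs ys : List ℕ} → Unique xs → (∀ {z} → z ∈ xs → z ∈ ys) → length xs ≤ length ys
unique-⊆⇒length≤ {xs} {ys} xs! xs⊆ys = Fin.injective⇒≤ position-injective
  where
  position : Fin (length xs) → Fin (length ys)
  position i = Any.index (xs⊆ys (∈-lookup {xs = xs} i))
  position-injective : Injective _≡_ _≡_ position
  position-injective {i} {j} e = unique-lookup-injective xs! (begin
    lookup xs i            ≡⟨ lookup-index (xs⊆ys (∈-lookup {xs = xs} i)) ⟩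
    lookup ys (position i) ≡⟨ cong (lookup ys) e ⟩
    lookup ys (position j) ≡⟨ lookup-index (xs⊆ys (∈-lookup {xs = xs} j)) ⟨
    lookup xs j            ∎)
    where open ≡-Reasoning

module _ (E : Graph) (f : Labeling E) where

  private
    sums = deduplicate ℕ._≟_ (map (vsum E f) (vertices E))

    endpoint₁ : ∀ {e} → e ∈ E → proj₁ e ∈ vertices E
    endpoint₁ e∈E = ∈-concatMap⁺ (λ e → proj₁ e ∷ proj₂ e ∷ []) (Any.map (λ { refl → here refl }) e∈E)

    endpoint₂ : ∀ {e} → e ∈ E → proj₂ e ∈ vertices E
    endpoint₂ e∈E = ∈-concatMap⁺ (λ e → proj₁ e ∷ proj₂ e ∷ []) (Any.map (λ { refl → there (here refl) }) e∈E)

    sum∈sums : ∀ {x} → x ∈ vertices E → vsum E f x ∈ sums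
    sum∈sums x∈V = ∈-deduplicate⁺ ℕ._≟_ (∈-map⁺ (vsum E f) x∈V)

    edge-sums-differ : IsLocalAntimagic E f → ∀ {e} → e ∈ E → vsum E f (proj₁ e) ≢ vsum E f (proj₂ e)
    edge-sums-differ la e∈E =
      subst (λ e → vsum E f (proj₁ e) ≢ vsum E f (proj₂ e)) (sym (lookup-index e∈E)) (la (Any.index e∈E))

  triangle⇒3≤colours : ∀ {a b c} → (a , b) ∈ E → (c , a) ∈ E → (c , b) ∈ E →
                       IsLocalAntimagic E f → 3 ≤ colours E f
  triangle⇒3≤colours {a} {b} {c} ab ca cb la = unique-⊆⇒length≤ distinct ⊆sums
    where
    distinct : Unique (vsum E f c ∷ vsum E f a ∷ vsum E f b ∷ [])
    distinct = (edge-sums-differ la ca ∷ edge-sums-differ la cb ∷ []) ∷ (edge-sums-differ la ab ∷ []) ∷ [] ∷ []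
    ⊆sums : ∀ {z} → z ∈ vsum E f c ∷ vsum E f a ∷ vsum E f b ∷ [] → z ∈ sums
    ⊆sums (here refl)                 = sum∈sums (endpoint₁ ca)
    ⊆sums (there (here refl))         = sum∈sums (endpoint₁ ab)
    ⊆sums (there (there (here refl))) = sum∈sums (endpoint₂ ab)

  module _ {C : Set} (κ : Vtx → C) (value : C → ℕ) where

    SumsFollow : Vtx × Vtx → Set
    SumsFollow (u , v) = vsum E f u ≡ value (κ u) × vsum E f v ≡ value (κ v) × κ u ≢ κ v

    sumsFollow⇒localAntimagic : Injective _≡_ _≡_ value → All SumsFollow E → IsLocalAntimagic E f
    sumsFollow⇒localAntimagic value-inj follows k sums≡ =
      let (σu , σv , κu≢κv) = All.lookup follows (∈-lookup {xs = E} k)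
      in κu≢κv (value-inj (trans (sym σu) (trans sums≡ σv)))

    sumsFollow⇒colours≤ : All SumsFollow E → (cs : List C) → (∀ c → c ∈ cs) → colours E f ≤ length cs
    sumsFollow⇒colours≤ follows cs cs-complete =
      subst (colours E f ≤_) (List.length-map value cs)
        (unique-⊆⇒length≤ (deduplicate-! ℕ._≟_ _)
                           (λ z∈ → All.lookup sums∈values (∈-deduplicate⁻ ℕ._≟_ _ z∈)))
      where
      sum∈values : ∀ x → vsum E f x ≡ value (κ x) → vsum E f x ∈ map value cs
      sum∈values x σx = subst (_∈ map value cs) (sym σx) (∈-map⁺ value (cs-complete (κ x)))
      sums∈values : All (_∈ map value cs) (map (vsum E f) (vertices E))
      sums∈values = All.map⁺ (All.concat⁺ (All.map⁺ (All.map (λ { {u , v} (σu , σv , _) →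
                      sum∈values u σu ∷ sum∈values v σv ∷ [] }) follows)))

    sumsFollow-image : ∀ {A : Set} (φ : A → Vtx) → (∀ v → vsum E f (φ v) ≡ value (κ (φ v))) →
                       ∀ es → All (λ e → κ (φ (proj₁ e)) ≢ κ (φ (proj₂ e))) es →
                       All SumsFollow (map (mapEdge φ) es)
    sumsFollow-image φ φ-sums es proper =
      All.map⁺ (All.map (λ {e} κ≢ → φ-sums (proj₁ e) , φ-sums (proj₂ e) , κ≢) proper)

-- The labels of a unit

-- A unit consists of two paths a and b with vertices p₀ p₁ p₂, their edges e₁ = p₀p₁ and
-- e₂ = p₁p₂, and the spokes hₖ joining a hub to pₖ.
data Role : Set where
  e1a e2a h0a h1a h2a e1b e2b h0b h1b h2b : Role

mirror : ℕ → ℕ → ℕ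
mirror M q = M ∸ suc q

mirror-split : ∀ {M q} → q < M → q + suc (mirror M q) ≡ M
mirror-split {M} {q} q<M = trans (ℕ.+-suc q (mirror M q)) (ℕ.m+[n∸m]≡n q<M)

-- Facts about a unit q < M are proved for M = q + suc q̄, where they are polynomial identities.
atMirror : ∀ (P : ℕ → ℕ → ℕ → Set) → (∀ q q̄ → P (q + suc q̄) q q̄) → ∀ {M q} → q < M → P M q (mirror M q)
atMirror P P-split {M} {q} q<M = subst (λ m → P m q (mirror M q)) (mirror-split q<M) (P-split q (mirror M q))

widthAt : List ℕ → ℕ → ℕ
widthAt []       _       = 0
widthAt (w ∷ _)  zero    = w
widthAt (_ ∷ ws) (suc b) = widthAt ws b

locate : ℕ → List ℕ → ℕ → ℕ × ℕ
locate M []       e = 0 , e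
locate M (w ∷ ws) e = if does (e <? w * M) then (0 , e) else map₁ suc (locate M ws (e ∸ w * M))

locate-start : ∀ M ws b {y} → y < widthAt ws b * M → locate M ws (sum (take b ws) * M + y) ≡ (b , y)
locate-start M (w ∷ ws) zero    {y} y<w =
  cong (λ t → if t then (0 , y) else map₁ suc (locate M ws (y ∸ w * M))) (dec-true (y <? w * M) y<w)
locate-start M (w ∷ ws) (suc b) {y} y<w = begin
  locate M (w ∷ ws) e
    ≡⟨ cong (λ t → if t then (0 , e) else map₁ suc (locate M ws (e ∸ w * M))) (dec-false (e <? w * M) e≮w*M) ⟩
  map₁ suc (locate M ws (e ∸ w * M))
    ≡⟨ cong (λ e′ → map₁ suc (locate M ws e′)) e∸w*M ⟩
  map₁ suc (locate M ws rest)
    ≡⟨ cong (map₁ suc) (locate-start M ws b y<w) ⟩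
  (suc b , y)
    ∎
  where
  open ≡-Reasoning
  rest = sum (take b ws) * M + y
  e = sum (take (suc b) (w ∷ ws)) * M + y
  e≡ : e ≡ w * M + rest
  e≡ = trans (cong (_+ y) (ℕ.*-distribʳ-+ M w _)) (ℕ.+-assoc (w * M) _ y)
  e≮w*M : ¬ e < w * M
  e≮w*M = ℕ.≤⇒≯ (subst (w * M ≤_) (sym e≡) (ℕ.m≤m+n (w * M) rest))
  e∸w*M : e ∸ w * M ≡ rest
  e∸w*M = trans (cong (_∸ w * M) e≡) (ℕ.m+n∸m≡n (w * M) rest)

start+width≤sum : ∀ ws b → sum (take b ws) + widthAt ws b ≤ sum ws
start+width≤sum []       zero    = z≤n
start+width≤sum []       (suc b) = z≤n
start+width≤sum (w ∷ ws) zero    = ℕ.m≤m+n w (sum ws)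
start+width≤sum (w ∷ ws) (suc b) = ℕ.≤-trans (ℕ.≤-reflexive (ℕ.+-assoc w _ _)) (ℕ.+-monoʳ-≤ w (start+width≤sum ws b))

start+offset<sum : ∀ M ws b {y} → y < widthAt ws b * M → sum (take b ws) * M + y < sum ws * M
start+offset<sum M ws b {y} y<w = begin-strict
  sum (take b ws) * M + y                 <⟨ ℕ.+-monoʳ-< _ y<w ⟩
  sum (take b ws) * M + widthAt ws b * M  ≡⟨ ℕ.*-distribʳ-+ M (sum (take b ws)) _ ⟨
  (sum (take b ws) + widthAt ws b) * M    ≤⟨ ℕ.*-monoˡ-≤ M (start+width≤sum ws b) ⟩
  sum ws * M                              ∎
  where open ℕ.≤-Reasoning

-- The codes 0, …, 10M - 1 of the labels are cut into eight bands. A band of width M lists one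
-- role along q or along q̄ = M - 1 - q; a band of width 2M interleaves two roles by parity.
bandWidths : List ℕ
bandWidths = 1 ∷ 2 ∷ 1 ∷ 1 ∷ 2 ∷ 1 ∷ 1 ∷ 1 ∷ []

band : Role → ℕ
band e1a = 0
band h2a = 1
band e2b = 1
band e1b = 2
band h0b = 3
band h2b = 4
band e2a = 4
band h0a = 5
band h1a = 6
band h1b = 7

offset : ℕ → ℕ → Role → ℕ
offset q q̄ e1a = q
offset q q̄ h2a = 2 * q
offset q q̄ e2b = suc (2 * q)
offset q q̄ e1b = q̄
offset q q̄ h0b = q
offset q q̄ h2b = 2 * q̄
offset q q̄ e2a = suc (2 * q̄)
offset q q̄ h0a = q̄
offset q q̄ h1a = q
offset q q̄ h1b = q̄

code : ℕ → ℕ → ℕ → Role → ℕ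
code M q q̄ ρ = sum (take (band ρ) bandWidths) * M + offset q q̄ ρ

unitLabels : ℕ → ℕ → ℕ → List Role → List ℕ
unitLabels M q q̄ = map (λ ρ → suc (code M q q̄ ρ))

unpair : Role → Role → ℕ → Role × ℕ
unpair ρ₀ ρ₁ zero          = ρ₀ , 0
unpair ρ₀ ρ₁ (suc zero)    = ρ₁ , 0
unpair ρ₀ ρ₁ (suc (suc y)) = map₂ suc (unpair ρ₀ ρ₁ y)

unpair-even : ∀ ρ₀ ρ₁ x → unpair ρ₀ ρ₁ (2 * x) ≡ (ρ₀ , x)
unpair-even ρ₀ ρ₁ zero    = refl
unpair-even ρ₀ ρ₁ (suc x) rewrite ℕ.+-suc x (x + 0) | unpair-even ρ₀ ρ₁ x = refl

unpair-odd : ∀ ρ₀ ρ₁ x → unpair ρ₀ ρ₁ (suc (2 * x)) ≡ (ρ₁ , x)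
unpair-odd ρ₀ ρ₁ zero    = refl
unpair-odd ρ₀ ρ₁ (suc x) rewrite ℕ.+-suc x (x + 0) | unpair-odd ρ₀ ρ₁ x = refl

unband : ℕ → ℕ → ℕ → Role × ℕ
unband M 0 y = e1a , y
unband M 1 y = unpair h2a e2b y
unband M 2 y = e1b , mirror M y
unband M 3 y = h0b , y
unband M 4 y = map₂ (mirror M) (unpair h2b e2a y)
unband M 5 y = h0a , mirror M y
unband M 6 y = h1a , y
unband M _ y = h1b , mirror M y

decode : ℕ → ℕ → Role × ℕ
decode M e = uncurry (unband M) (locate M bandWidths e)

module _ (q q̄ : ℕ) where

  private
    M = q + suc q̄

    q<M : q < M
    q<M = ℕ.m<m+n q (s≤s z≤n)

    q̄<M : q̄ < M
    q̄<M = ℕ.m≤n+m (suc q̄) q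

    single< : ∀ {x} → x < M → x < 1 * M
    single< {x} = subst (x <_) (sym (ℕ.*-identityˡ M))

    double< : ∀ {x} → x < M → 2 * x < 2 * M
    double< = ℕ.*-monoʳ-< 2

    double+1< : ∀ {x} → x < M → suc (2 * x) < 2 * M
    double+1< {x} x<M = ℕ.≤-trans (ℕ.≤-reflexive (sym (ℕ.*-suc 2 x))) (ℕ.*-monoʳ-≤ 2 x<M)

    mirror-q̄ : mirror M q̄ ≡ q
    mirror-q̄ = ℕ.m+n∸n≡m q (suc q̄)

  offset<width : ∀ ρ → offset q q̄ ρ < widthAt bandWidths (band ρ) * M
  offset<width e1a = single< q<M
  offset<width h2a = double< q<M
  offset<width e2b = double+1< q<M
  offset<width e1b = single< q̄<M
  offset<width h0b = single< q<M
  offset<width h2b = double< q̄<M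
  offset<width e2a = double+1< q̄<M
  offset<width h0a = single< q̄<M
  offset<width h1a = single< q<M
  offset<width h1b = single< q̄<M

  unband-offset : ∀ ρ → unband M (band ρ) (offset q q̄ ρ) ≡ (ρ , q)
  unband-offset e1a = refl
  unband-offset h2a = unpair-even h2a e2b q
  unband-offset e2b = unpair-odd h2a e2b q
  unband-offset e1b = cong (e1b ,_) mirror-q̄
  unband-offset h0b = refl
  unband-offset h2b = trans (cong (map₂ (mirror M)) (unpair-even h2b e2a q̄)) (cong (h2b ,_) mirror-q̄)
  unband-offset e2a = trans (cong (map₂ (mirror M)) (unpair-odd h2b e2a q̄)) (cong (e2a ,_) mirror-q̄)
  unband-offset h0a = cong (h0a ,_) mirror-q̄
  unband-offset h1a = refl
  unband-offset h1b = cong (h1b ,_) mirror-q̄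

  decode-code : ∀ ρ → decode M (code M q q̄ ρ) ≡ (ρ , q)
  decode-code ρ = trans (cong (uncurry (unband M)) (locate-start M bandWidths (band ρ) (offset<width ρ))) (unband-offset ρ)

  code<10*M : ∀ ρ → code M q q̄ ρ < 10 * M
  code<10*M ρ = start+offset<sum M bandWidths (band ρ) (offset<width ρ)

data Colour : Set where
  end mid hub : Colour

pathColour : Fin 3 → Colour
pathColour 0F = end
pathColour 1F = mid
pathColour 2F = end

unitSum : ℕ → Colour → ℕ
unitSum M end = suc (8 * M)
unitSum M mid = suc (suc (15 * M))
unitSum M hub = suc (19 * M)

unitSum-mid<hub : ∀ M → 1 ≤ M → unitSum M mid < unitSum M hub
unitSum-mid<hub (suc m) _ = subst (suc (unitSum (suc m) mid) ≤_) (slack m) (ℕ.m≤m+n _ (4 * m + 2))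
  where
  slack : ∀ m → suc (suc (suc (15 * suc m))) + (4 * m + 2) ≡ suc (19 * suc m)
  slack = solve-∀

-- The label sums at the vertices of a unit: a₀ … b₂ along the paths, y and z at the hubs of a
-- blade of DF(2s), apex at the centre of two blades of FB(s); each summand is suc (code M q q̄ ρ).
private
  sum-a₀ : ∀ q q̄ → let M = q + suc q̄ in suc q + (suc (7 * M + q̄) + 0) ≡ suc (8 * M)
  sum-a₀ = solve-∀
  sum-a₁ : ∀ q q̄ → let M = q + suc q̄ in suc q + (suc (5 * M + suc (2 * q̄)) + (suc (8 * M + q) + 0)) ≡ suc (suc (15 * M))
  sum-a₁ = solve-∀
  sum-a₂ : ∀ q q̄ → let M = q + suc q̄ in suc (5 * M + suc (2 * q̄)) + (suc (1 * M + 2 * q) + 0) ≡ suc (8 * M)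
  sum-a₂ = solve-∀
  sum-b₀ : ∀ q q̄ → let M = q + suc q̄ in suc (3 * M + q̄) + (suc (4 * M + q) + 0) ≡ suc (8 * M)
  sum-b₀ = solve-∀
  sum-b₁ : ∀ q q̄ → let M = q + suc q̄ in suc (3 * M + q̄) + (suc (1 * M + suc (2 * q)) + (suc (9 * M + q̄) + 0)) ≡ suc (suc (15 * M))
  sum-b₁ = solve-∀
  sum-b₂ : ∀ q q̄ → let M = q + suc q̄ in suc (1 * M + suc (2 * q)) + (suc (5 * M + 2 * q̄) + 0) ≡ suc (8 * M)
  sum-b₂ = solve-∀
  sum-y : ∀ q q̄ → let M = q + suc q̄ in suc (7 * M + q̄) + (suc (1 * M + 2 * q) + (suc (9 * M + q̄) + 0)) ≡ suc (19 * M)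
  sum-y = solve-∀
  sum-z : ∀ q q̄ → let M = q + suc q̄ in suc (4 * M + q) + (suc (5 * M + 2 * q̄) + (suc (8 * M + q) + 0)) ≡ suc (19 * M)
  sum-z = solve-∀
  sum-apex : ∀ q q̄ → let M = q + suc q̄ in
             suc (7 * M + q̄) + (suc (8 * M + q) + (suc (1 * M + 2 * q) + (suc (4 * M + q) + (suc (9 * M + q̄) + (suc (5 * M + 2 * q̄) + 0)))))
               ≡ suc (19 * M) + suc (19 * M)
  sum-apex = solve-∀

module Local {A : Set} (_≟A_ : DecidableEquality A) where

  localContribution : A → A × A → ℕ → ℕ
  localContribution v (a , b) ℓ = if ⌊ v ≟A a ⌋ ∨ ⌊ v ≟A b ⌋ then ℓ else 0

  module _ (φ : A → Vtx) where

    private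
      ≟-image : Injective _≡_ _≡_ φ → ∀ v a → ⌊ φ v ≟V φ a ⌋ ≡ ⌊ v ≟A a ⌋
      ≟-image φ-inj v a = trans (isYes≗does (φ v ≟V φ a))
        (trans (does-⇔ (mk⇔ φ-inj (cong φ)) (φ v ≟V φ a) (v ≟A a)) (sym (isYes≗does (v ≟A a))))

      ≟-outside : ∀ {x} a → x ≢ φ a → ⌊ x ≟V φ a ⌋ ≡ false
      ≟-outside {x} a x≢φa = trans (isYes≗does (x ≟V φ a)) (dec-false (x ≟V φ a) x≢φa)

    sum-contribution-image : Injective _≡_ _≡_ φ → ∀ v es ℓs →
      sum (zipWith (contribution (φ v)) (map (mapEdge φ) es) ℓs) ≡ sum (zipWith (localContribution v) es ℓs)
    sum-contribution-image φ-inj v []             ℓs       = refl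
    sum-contribution-image φ-inj v (_ ∷ _)        []       = refl
    sum-contribution-image φ-inj v ((a , b) ∷ es) (ℓ ∷ ℓs) = cong₂ _+_
      (cong (λ t → if t then ℓ else 0) (cong₂ _∨_ (≟-image φ-inj v a) (≟-image φ-inj v b)))
      (sum-contribution-image φ-inj v es ℓs)

    sum-contribution-outside : ∀ x → (∀ a → x ≢ φ a) → ∀ es ℓs →
      sum (zipWith (contribution x) (map (mapEdge φ) es) ℓs) ≡ 0
    sum-contribution-outside x x∉ []             ℓs       = refl
    sum-contribution-outside x x∉ (_ ∷ _)        []       = refl
    sum-contribution-outside x x∉ ((a , b) ∷ es) (ℓ ∷ ℓs) = cong₂ _+_
      (cong (λ t → if t then ℓ else 0) (cong₂ _∨_ (≟-outside a (x∉ a)) (≟-outside b (x∉ b))))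
      (sum-contribution-outside x x∉ es ℓs)

    sum-contribution-unit : Injective _≡_ _≡_ φ → ∀ (unit : List ((A × A) × Role)) v (g : ℕ → ℕ) →
      (∀ q q̄ → sum (zipWith (localContribution v) (map proj₁ unit) (unitLabels (q + suc q̄) q q̄ (map proj₂ unit)))
                 ≡ g (q + suc q̄)) →
      ∀ {M q} → q < M →
      sum (zipWith (contribution (φ v)) (map (mapEdge φ) (map proj₁ unit)) (unitLabels M q (mirror M q) (map proj₂ unit))) ≡ g M
    sum-contribution-unit φ-inj unit v g unit-sum {M} {q} q<M =
      trans (sum-contribution-image φ-inj v (map proj₁ unit) (unitLabels M q (mirror M q) (map proj₂ unit)))
            (atMirror (λ m q q̄ → sum (zipWith (localContribution v) (map proj₁ unit) (unitLabels m q q̄ (map proj₂ unit)))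
                                   ≡ g m)
                      unit-sum q<M)

data DFLocal : Set where
  pt        : Fin 2 → Fin 3 → DFLocal
  hubY hubZ : DFLocal

_≟DF_ : DecidableEquality DFLocal
pt i p ≟DF pt i′ p′ with i Fin.≟ i′ | p Fin.≟ p′
... | yes refl | yes refl = yes refl
... | no i≢i′  | _        = no λ { refl → i≢i′ refl }
... | yes _    | no p≢p′  = no λ { refl → p≢p′ refl }
pt _ _ ≟DF hubY   = no λ ()
pt _ _ ≟DF hubZ   = no λ ()
hubY   ≟DF pt _ _ = no λ ()
hubY   ≟DF hubY   = yes refl
hubY   ≟DF hubZ   = no λ ()
hubZ   ≟DF pt _ _ = no λ ()
hubZ   ≟DF hubY   = no λ ()
hubZ   ≟DF hubZ   = yes refl

-- Labels are handed out by edge position, so this list follows the order of a blade in `DF`.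
dfUnit : List ((DFLocal × DFLocal) × Role)
dfUnit = ((pt S₁ p0 , pt S₁ p1) , e1a) ∷ ((pt S₁ p1 , pt S₁ p2) , e2a) ∷
         ((pt S₂ p0 , pt S₂ p1) , e1b) ∷ ((pt S₂ p1 , pt S₂ p2) , e2b) ∷
         ((hubY , pt S₁ p0) , h0a) ∷ ((hubY , pt S₁ p2) , h2a) ∷ ((hubY , pt S₂ p1) , h1b) ∷
         ((hubZ , pt S₂ p0) , h0b) ∷ ((hubZ , pt S₂ p2) , h2b) ∷ ((hubZ , pt S₁ p1) , h1a) ∷ []

dfColour : DFLocal → Colour
dfColour (pt _ p) = pathColour p
dfColour hubY     = hub
dfColour hubZ     = hub

dfUnit-sum : ∀ q q̄ v → let M = q + suc q̄ in
             sum (zipWith (Local.localContribution _≟DF_ v) (map proj₁ dfUnit) (unitLabels M q q̄ (map proj₂ dfUnit)))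
               ≡ unitSum M (dfColour v)
dfUnit-sum q q̄ (pt 0F 0F) = sum-a₀ q q̄
dfUnit-sum q q̄ (pt 0F 1F) = sum-a₁ q q̄
dfUnit-sum q q̄ (pt 0F 2F) = sum-a₂ q q̄
dfUnit-sum q q̄ (pt 1F 0F) = sum-b₀ q q̄
dfUnit-sum q q̄ (pt 1F 1F) = sum-b₁ q q̄
dfUnit-sum q q̄ (pt 1F 2F) = sum-b₂ q q̄
dfUnit-sum q q̄ hubY       = sum-y q q̄
dfUnit-sum q q̄ hubZ       = sum-z q q̄

data FBLocal : Set where
  pt   : Fin 2 → Fin 3 → FBLocal
  apex : FBLocal

_≟FB_ : DecidableEquality FBLocal
pt h p ≟FB pt h′ p′ with h Fin.≟ h′ | p Fin.≟ p′
... | yes refl | yes refl = yes refl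
... | no h≢h′  | _        = no λ { refl → h≢h′ refl }
... | yes _    | no p≢p′  = no λ { refl → p≢p′ refl }
pt _ _ ≟FB apex   = no λ ()
apex   ≟FB pt _ _ = no λ ()
apex   ≟FB apex   = yes refl

-- Two consecutive blades of `FB`, in its order.
fbUnit : List ((FBLocal × FBLocal) × Role)
fbUnit = ((pt S₁ p0 , pt S₁ p1) , e1a) ∷ ((pt S₁ p1 , pt S₁ p2) , e2a) ∷
         ((apex , pt S₁ p0) , h0a) ∷ ((apex , pt S₁ p1) , h1a) ∷ ((apex , pt S₁ p2) , h2a) ∷
         ((pt S₂ p0 , pt S₂ p1) , e1b) ∷ ((pt S₂ p1 , pt S₂ p2) , e2b) ∷
         ((apex , pt S₂ p0) , h0b) ∷ ((apex , pt S₂ p1) , h1b) ∷ ((apex , pt S₂ p2) , h2b) ∷ []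

fbUnitSum : ℕ → FBLocal → ℕ
fbUnitSum M (pt _ p) = unitSum M (pathColour p)
fbUnitSum M apex     = unitSum M hub + unitSum M hub

fbUnit-sum : ∀ q q̄ v → let M = q + suc q̄ in
             sum (zipWith (Local.localContribution _≟FB_ v) (map proj₁ fbUnit) (unitLabels M q q̄ (map proj₂ fbUnit)))
               ≡ fbUnitSum M v
fbUnit-sum q q̄ (pt 0F 0F) = sum-a₀ q q̄
fbUnit-sum q q̄ (pt 0F 1F) = sum-a₁ q q̄
fbUnit-sum q q̄ (pt 0F 2F) = sum-a₂ q q̄
fbUnit-sum q q̄ (pt 1F 0F) = sum-b₀ q q̄
fbUnit-sum q q̄ (pt 1F 1F) = sum-b₁ q q̄
fbUnit-sum q q̄ (pt 1F 2F) = sum-b₂ q q̄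
fbUnit-sum q q̄ apex       = sum-apex q q̄

slotOf : ℕ → Fin 10
slotOf k = fromℕ< (m%n<n k 10)

slotOf-+ : ∀ q u → slotOf (q * 10 + u) ≡ slotOf u
slotOf-+ q u = Fin.toℕ-injective (trans (Fin.toℕ-fromℕ< _) (trans ([q*n+u]%n≡u%n q u) (sym (Fin.toℕ-fromℕ< _))))

slotOf-% : ∀ {i j} → slotOf i ≡ slotOf j → i % 10 ≡ j % 10
slotOf-% e = trans (sym (Fin.toℕ-fromℕ< _)) (trans (cong toℕ e) (Fin.toℕ-fromℕ< _))

slotRole : Bool → Fin 10 → Role
slotRole true  = lookup (map proj₂ dfUnit)
slotRole false = lookup (map proj₂ fbUnit)

roleSlot : Bool → Role → Fin 10
roleSlot true  e1a = 0F
roleSlot true  e2a = 1F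
roleSlot true  e1b = 2F
roleSlot true  e2b = 3F
roleSlot true  h0a = 4F
roleSlot true  h2a = 5F
roleSlot true  h1b = 6F
roleSlot true  h0b = 7F
roleSlot true  h2b = 8F
roleSlot true  h1a = 9F
roleSlot false e1a = 0F
roleSlot false e2a = 1F
roleSlot false h0a = 2F
roleSlot false h1a = 3F
roleSlot false h2a = 4F
roleSlot false e1b = 5F
roleSlot false e2b = 6F
roleSlot false h0b = 7F
roleSlot false h1b = 8F
roleSlot false h2b = 9F

roleSlot-slotRole : ∀ b u → roleSlot b (slotRole b u) ≡ u
roleSlot-slotRole true  = from-yes (Fin.all? λ u → roleSlot true (slotRole true u) Fin.≟ u)
roleSlot-slotRole false = from-yes (Fin.all? λ u → roleSlot false (slotRole false u) Fin.≟ u)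

slotRole-injective : ∀ b → Injective _≡_ _≡_ (slotRole b)
slotRole-injective b {u} {u′} e = trans (sym (roleSlot-slotRole b u)) (trans (cong (roleSlot b) e) (roleSlot-slotRole b u′))

dfEmbed : ℕ → ℕ → DFLocal → Vtx
dfEmbed c j (pt i p) = dfP c i j p
dfEmbed c j hubY     = dfY c
dfEmbed c j hubZ     = dfZ c

fbEmbed : ℕ → FBLocal → Vtx
fbEmbed t (pt h p) = fbP (t * 2 + toℕ h) p
fbEmbed t apex     = fbC

dfEmbed-injective : ∀ {c j} → Injective _≡_ _≡_ (dfEmbed c j)
dfEmbed-injective {x = pt _ _} {pt _ _} refl = refl
dfEmbed-injective {x = hubY}   {hubY}   refl = refl
dfEmbed-injective {x = hubZ}   {hubZ}   refl = refl
dfEmbed-injective {x = pt _ _} {hubY}   ()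
dfEmbed-injective {x = pt _ _} {hubZ}   ()
dfEmbed-injective {x = hubY}   {pt _ _} ()
dfEmbed-injective {x = hubY}   {hubZ}   ()
dfEmbed-injective {x = hubZ}   {pt _ _} ()
dfEmbed-injective {x = hubZ}   {hubY}   ()

fbP-injective : ∀ {j j′ p p′} → fbP j p ≡ fbP j′ p′ → j ≡ j′ × p ≡ p′
fbP-injective refl = refl , refl

fbEmbed-injective : ∀ {t} → Injective _≡_ _≡_ (fbEmbed t)
fbEmbed-injective {t} {pt h p} {pt h′ p′} e with fbP-injective e
... | j≡j′ , refl rewrite Fin.toℕ-injective (ℕ.+-cancelˡ-≡ (t * 2) (toℕ h) (toℕ h′) j≡j′) = refl
fbEmbed-injective {x = apex}   {apex}   refl = refl
fbEmbed-injective {x = pt _ _} {apex}   ()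
fbEmbed-injective {x = apex}   {pt _ _} ()

dfEmbed≢fbEmbed : ∀ {c j t} v w → dfEmbed c j v ≢ fbEmbed t w
dfEmbed≢fbEmbed (pt _ _) (pt _ _) ()
dfEmbed≢fbEmbed (pt _ _) apex     ()
dfEmbed≢fbEmbed hubY     (pt _ _) ()
dfEmbed≢fbEmbed hubY     apex     ()
dfEmbed≢fbEmbed hubZ     (pt _ _) ()
dfEmbed≢fbEmbed hubZ     apex     ()

dfCopy : Vtx → ℕ
dfCopy (dfP c _ _ _) = c
dfCopy (dfY c)       = c
dfCopy (dfZ c)       = c
dfCopy _             = 0

dfCopy-dfEmbed : ∀ c j v → dfCopy (dfEmbed c j v) ≡ c
dfCopy-dfEmbed c j (pt _ _) = refl
dfCopy-dfEmbed c j hubY     = refl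
dfCopy-dfEmbed c j hubZ     = refl

≢dfEmbed-copy : ∀ {x c} j → dfCopy x ≢ c → ∀ v → x ≢ dfEmbed c j v
≢dfEmbed-copy j x≢c v refl = x≢c (dfCopy-dfEmbed _ j v)

≢dfEmbed-blade : ∀ {c i j p} j′ → j′ ≢ j → ∀ v → dfP c i j p ≢ dfEmbed c j′ v
≢dfEmbed-blade j′ j′≢j (pt _ _) refl = j′≢j refl
≢dfEmbed-blade j′ j′≢j hubY     ()
≢dfEmbed-blade j′ j′≢j hubZ     ()

≢fbEmbed-pair : ∀ {t h p} t′ → t′ ≢ t → ∀ v → fbEmbed t (pt h p) ≢ fbEmbed t′ v
≢fbEmbed-pair {t} {h} t′ t′≢t (pt h′ _) e = t′≢t (begin
  t′                    ≡⟨ [q*n+u]/n≡q t′ (Fin.toℕ<n h′) ⟨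
  (t′ * 2 + toℕ h′) / 2 ≡⟨ cong (_/ 2) (proj₁ (fbP-injective e)) ⟨
  (t * 2 + toℕ h) / 2   ≡⟨ [q*n+u]/n≡q t (Fin.toℕ<n h) ⟩
  t                     ∎)
  where open ≡-Reasoning
≢fbEmbed-pair t′ t′≢t apex ()

colour : Vtx → Colour
colour (dfP _ _ _ p) = pathColour p
colour (dfY _)       = hub
colour (dfZ _)       = hub
colour (fbP _ p)     = pathColour p
colour fbC           = hub

-- The labeling of DF_r(2s)

module DFrLabeling (r t : ℕ) where

  S R M : ℕ
  S = t * 2
  R = r * S
  M = R + t

  E : Graph
  E = DFr r S

  isDF : ℕ → Bool
  isDF q = does (q <? R)

  unitRole : ℕ → Fin 10 → Role
  unitRole q = slotRole (isDF q)

  -- Edge position k lies in unit k / 10, at slot k % 10. Units q < R are the blades of the copies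
  -- of DF(2s); unit R + t′ consists of the blades 2t′ and 2t′ + 1 of FB(s).
  σ : ℕ → ℕ
  σ k = code M (k / 10) (mirror M (k / 10)) (unitRole (k / 10) (slotOf k))

  σ-at : ∀ q {u} → u < 10 → σ (q * 10 + u) ≡ code M q (mirror M q) (unitRole q (slotOf u))
  σ-at q {u} u<10 rewrite [q*n+u]/n≡q q u<10 | slotOf-+ q u = refl

  dfBlade : ℕ → ℕ → Graph
  dfBlade c j = map (mapEdge (dfEmbed c j)) (map proj₁ dfUnit)

  fbPair : ℕ → Graph
  fbPair t′ = map (mapEdge (fbEmbed t′)) (map proj₁ fbUnit)

  E₁ : Graph
  E₁ = concatMap (DF S) (upTo r)

  E₁≡ : E₁ ≡ concat (applyUpTo (DF S) r)
  E₁≡ = cong concat (List.map-upTo (DF S) r)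

  DF≡ : ∀ c → DF S c ≡ concat (applyUpTo (dfBlade c) S)
  DF≡ c = cong concat (List.map-upTo (dfBlade c) S)

  FB≡ : FB S ≡ concat (applyUpTo fbPair t)
  FB≡ = trans (cong concat (List.map-upTo _ S)) (concat-applyUpTo-* _ t 2)

  length-DF : ∀ c → length (DF S c) ≡ S * 10
  length-DF c = trans (cong length (DF≡ c)) (length-concat-applyUpTo (dfBlade c) S (λ _ → refl))

  length-E₁ : length E₁ ≡ r * (S * 10)
  length-E₁ = trans (cong length E₁≡) (length-concat-applyUpTo (DF S) r length-DF)

  length-E : length E ≡ r * (S * 10) + t * 10
  length-E = trans (List.length-++ E₁)
    (cong₂ _+_ length-E₁ (trans (cong length FB≡) (length-concat-applyUpTo fbPair t (λ _ → refl))))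

  length-E≡M*10 : length E ≡ M * 10
  length-E≡M*10 = trans length-E (distrib r t)
    where
    distrib : ∀ r t → r * (t * 2 * 10) + t * 10 ≡ (r * (t * 2) + t) * 10
    distrib = solve-∀

  private
    n = length E

    unit<M : ∀ {k} → k < n → k / 10 < M
    unit<M {k} k<n = m<n*o⇒m/o<n (subst (k <_) length-E≡M*10 k<n)

  σ<n : ∀ {k} → k < n → σ k < n
  σ<n {k} k<n = subst (σ k <_) (trans (ℕ.*-comm 10 M) (sym length-E≡M*10))
    (atMirror (λ m q q̄ → ∀ ρ → code m q q̄ ρ < 10 * m) code<10*M (unit<M k<n) (unitRole (k / 10) (slotOf k)))

  decode-σ : ∀ k → k < n → decode M (σ k) ≡ (unitRole (k / 10) (slotOf k) , k / 10)
  decode-σ k k<n = atMirror (λ m q q̄ → ∀ ρ → decode m (code m q q̄ ρ) ≡ (ρ , q)) decode-code (unit<M k<n)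
                            (unitRole (k / 10) (slotOf k))

  σ-injective : ∀ {i j} → i < n → j < n → σ i ≡ σ j → i ≡ j
  σ-injective {i} {j} i<n j<n σi≡σj =
    %-/-injective {10} (slotOf-% {i} {j} (slotRole-injective (isDF (j / 10)) roles≡)) units≡
    where
    decoded : (unitRole (i / 10) (slotOf i) , i / 10) ≡ (unitRole (j / 10) (slotOf j) , j / 10)
    decoded = trans (sym (decode-σ i i<n)) (trans (cong (decode M) σi≡σj) (decode-σ j j<n))
    units≡ : i / 10 ≡ j / 10
    units≡ = cong proj₂ decoded
    roles≡ : unitRole (j / 10) (slotOf i) ≡ unitRole (j / 10) (slotOf j)
    roles≡ = subst (λ q → unitRole q (slotOf i) ≡ unitRole (j / 10) (slotOf j)) units≡ (cong proj₁ decoded)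

  labeling : ∃ λ (f : Labeling E) → ∀ k → label E f k ≡ suc (σ (toℕ k))
  labeling = permutation⇒labeling E σ σ<n σ-injective

  f : Labeling E
  f = proj₁ labeling

  dfLabels : ℕ → ℕ → List ℕ
  dfLabels c j = applyUpTo (λ u → suc (σ (c * (S * 10) + (j * 10 + u)))) 10

  fbLabels : ℕ → List ℕ
  fbLabels t′ = applyUpTo (λ u → suc (σ (r * (S * 10) + (t′ * 10 + u)))) 10

  dfBladeSum : Vtx → ℕ → ℕ → ℕ
  dfBladeSum x c j = sum (zipWith (contribution x) (dfBlade c j) (dfLabels c j))

  fbPairSum : Vtx → ℕ → ℕ
  fbPairSum x t′ = sum (zipWith (contribution x) (fbPair t′) (fbLabels t′))

  dfSum fbSum : Vtx → ℕ
  dfSum x = sum (applyUpTo (λ c → sum (applyUpTo (dfBladeSum x c) S)) r)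
  fbSum x = sum (applyUpTo (fbPairSum x) t)

  vsum≡dfSum+fbSum : ∀ x → vsum E f x ≡ dfSum x + fbSum x
  vsum≡dfSum+fbSum x = begin
    vsum E f x
      ≡⟨ vsum-zipWith E σ f (proj₂ labeling) x ⟩
    sum (zipWith (contribution x) E (applyUpTo (suc ∘ σ) (length E)))
      ≡⟨ cong (λ m → sum (zipWith (contribution x) E (applyUpTo (suc ∘ σ) m))) length-E ⟩
    sum (zipWith (contribution x) E (applyUpTo (suc ∘ σ) (r * (S * 10) + t * 10)))
      ≡⟨ cong (sum ∘ zipWith (contribution x) E) (applyUpTo-+ (suc ∘ σ) (r * (S * 10)) (t * 10)) ⟩
    sum (zipWith (contribution x) (E₁ ++ FB S) (L₁ ++ L₂))
      ≡⟨ sum-zipWith-++ (contribution x) E₁ (FB S) L₁ L₂ (trans length-E₁ (sym (List.length-applyUpTo _ _))) ⟩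
    sum (zipWith (contribution x) E₁ L₁) + sum (zipWith (contribution x) (FB S) L₂)
      ≡⟨ cong₂ _+_ E₁-sum FB-sum ⟩
    dfSum x + fbSum x
      ∎
    where
    open ≡-Reasoning
    L₁ = applyUpTo (suc ∘ σ) (r * (S * 10))
    L₂ = applyUpTo (λ i → suc (σ (r * (S * 10) + i))) (t * 10)
    DF-labels : ℕ → List ℕ
    DF-labels c = applyUpTo (λ u → suc (σ (c * (S * 10) + u))) (S * 10)
    E₁-sum : sum (zipWith (contribution x) E₁ L₁) ≡ dfSum x
    E₁-sum = begin
      sum (zipWith (contribution x) E₁ L₁)
        ≡⟨ cong (λ es → sum (zipWith (contribution x) es L₁)) E₁≡ ⟩
      sum (zipWith (contribution x) (concat (applyUpTo (DF S) r)) L₁)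
        ≡⟨ sum-zipWith-blocks (contribution x) (DF S) (suc ∘ σ) r (S * 10) length-DF ⟩
      sum (applyUpTo (λ c → sum (zipWith (contribution x) (DF S c) (DF-labels c))) r)
        ≡⟨ cong sum (applyUpTo-cong r λ c _ →
             trans (cong (λ es → sum (zipWith (contribution x) es (DF-labels c))) (DF≡ c))
                   (sum-zipWith-blocks (contribution x) (dfBlade c) (λ u → suc (σ (c * (S * 10) + u))) S 10 (λ _ → refl))) ⟩
      dfSum x
        ∎
    FB-sum : sum (zipWith (contribution x) (FB S) L₂) ≡ fbSum x
    FB-sum = trans (cong (λ es → sum (zipWith (contribution x) es L₂)) FB≡)
                   (sum-zipWith-blocks (contribution x) fbPair (λ i → suc (σ (r * (S * 10) + i))) t 10 (λ _ → refl))

  dfUnit<R : ∀ {c j} → c < r → j < S → c * S + j < R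
  dfUnit<R {c} {j} c<r j<S = begin-strict
    c * S + j  <⟨ ℕ.+-monoʳ-< (c * S) j<S ⟩
    c * S + S  ≡⟨ ℕ.+-comm (c * S) S ⟩
    suc c * S  ≤⟨ ℕ.*-monoˡ-≤ S c<r ⟩
    r * S      ∎
    where open ℕ.≤-Reasoning

  private
    position : ∀ a b c u → a * (b * 10) + (c * 10 + u) ≡ (a * b + c) * 10 + u
    position = solve-∀

  dfLabels≡ : ∀ {c j} → c < r → j < S →
              let q = c * S + j in dfLabels c j ≡ unitLabels M q (mirror M q) (map proj₂ dfUnit)
  dfLabels≡ {c} {j} c<r j<S = applyUpTo-cong 10 λ u u<10 → cong suc (begin
    σ (c * (S * 10) + (j * 10 + u))                      ≡⟨ cong σ (position c S j u) ⟩
    σ (q * 10 + u)                                       ≡⟨ σ-at q u<10 ⟩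
    code M q (mirror M q) (slotRole (isDF q) (slotOf u)) ≡⟨ cong (λ b → code M q (mirror M q) (slotRole b (slotOf u)))
                                                                 (dec-true (q <? R) (dfUnit<R c<r j<S)) ⟩
    code M q (mirror M q) (slotRole true (slotOf u))     ∎)
    where
    open ≡-Reasoning
    q = c * S + j

  fbLabels≡ : ∀ t′ → let q = R + t′ in fbLabels t′ ≡ unitLabels M q (mirror M q) (map proj₂ fbUnit)
  fbLabels≡ t′ = applyUpTo-cong 10 λ u u<10 → cong suc (begin
    σ (r * (S * 10) + (t′ * 10 + u))                     ≡⟨ cong σ (position r S t′ u) ⟩
    σ (q * 10 + u)                                       ≡⟨ σ-at q u<10 ⟩
    code M q (mirror M q) (slotRole (isDF q) (slotOf u)) ≡⟨ cong (λ b → code M q (mirror M q) (slotRole b (slotOf u)))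
                                                                 (dec-false (q <? R) (ℕ.≤⇒≯ (ℕ.m≤m+n R t′))) ⟩
    code M q (mirror M q) (slotRole false (slotOf u))    ∎)
    where
    open ≡-Reasoning
    q = R + t′

  dfBladeSum-own : ∀ {c j} → c < r → j < S → ∀ v → dfBladeSum (dfEmbed c j v) c j ≡ unitSum M (dfColour v)
  dfBladeSum-own {c} {j} c<r j<S v =
    trans (cong (sum ∘ zipWith (contribution (dfEmbed c j v)) (dfBlade c j)) (dfLabels≡ c<r j<S))
          (Local.sum-contribution-unit _≟DF_ (dfEmbed c j) (dfEmbed-injective {c} {j}) dfUnit v (λ M → unitSum M (dfColour v))
             (λ q q̄ → dfUnit-sum q q̄ v) (ℕ.<-≤-trans (dfUnit<R c<r j<S) (ℕ.m≤m+n R t)))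

  fbPairSum-own : ∀ {t′} → t′ < t → ∀ v → fbPairSum (fbEmbed t′ v) t′ ≡ fbUnitSum M v
  fbPairSum-own {t′} t′<t v =
    trans (cong (sum ∘ zipWith (contribution (fbEmbed t′ v)) (fbPair t′)) (fbLabels≡ t′))
          (Local.sum-contribution-unit _≟FB_ (fbEmbed t′) (fbEmbed-injective {t′}) fbUnit v (λ M → fbUnitSum M v)
             (λ q q̄ → fbUnit-sum q q̄ v) (ℕ.+-monoʳ-< R t′<t))

  dfBladeSum-outside : ∀ x c j → (∀ v → x ≢ dfEmbed c j v) → dfBladeSum x c j ≡ 0
  dfBladeSum-outside x c j x∉ = Local.sum-contribution-outside _≟DF_ (dfEmbed c j) x x∉ (map proj₁ dfUnit) (dfLabels c j)

  fbPairSum-outside : ∀ x t′ → (∀ v → x ≢ fbEmbed t′ v) → fbPairSum x t′ ≡ 0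
  fbPairSum-outside x t′ x∉ = Local.sum-contribution-outside _≟FB_ (fbEmbed t′) x x∉ (map proj₁ fbUnit) (fbLabels t′)

  colourSum : Colour → ℕ
  colourSum hub = S * unitSum M hub
  colourSum c   = unitSum M c

  colourSum-pathColour : ∀ p → colourSum (pathColour p) ≡ unitSum M (pathColour p)
  colourSum-pathColour 0F = refl
  colourSum-pathColour 1F = refl
  colourSum-pathColour 2F = refl

  dfSum-copy : ∀ x {c} → c < r → dfCopy x ≡ c → dfSum x ≡ sum (applyUpTo (dfBladeSum x c) S)
  dfSum-copy x {c} c<r copy≡c = sum-applyUpTo-single r c c<r λ c′ _ c′≢c →
    sum-applyUpTo-zero S λ j _ →
      dfBladeSum-outside x c′ j (≢dfEmbed-copy j λ copy≡c′ → c′≢c (trans (sym copy≡c′) copy≡c))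

  dfVertex-sum : ∀ {c j} → c < r → j < S → ∀ v → vsum E f (dfEmbed c j v) ≡ colourSum (colour (dfEmbed c j v))
  dfVertex-sum {c} {j} c<r j<S v = begin
    vsum E f x
      ≡⟨ vsum≡dfSum+fbSum x ⟩
    dfSum x + fbSum x
      ≡⟨ cong₂ _+_ (dfSum-copy x c<r (dfCopy-dfEmbed c j v))
                   (sum-applyUpTo-zero t λ t′ _ → fbPairSum-outside x t′ (dfEmbed≢fbEmbed v)) ⟩
    sum (applyUpTo (dfBladeSum x c) S) + 0
      ≡⟨ ℕ.+-identityʳ _ ⟩
    sum (applyUpTo (dfBladeSum x c) S)
      ≡⟨ blades v ⟩
    colourSum (colour x)
      ∎
    where
    open ≡-Reasoning
    x = dfEmbed c j v
    blades : ∀ v → sum (applyUpTo (dfBladeSum (dfEmbed c j v) c) S) ≡ colourSum (colour (dfEmbed c j v))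
    blades (pt i p) = begin
      sum (applyUpTo (dfBladeSum (dfP c i j p) c) S)
        ≡⟨ sum-applyUpTo-single S j j<S (λ j′ _ j′≢j →
             dfBladeSum-outside (dfP c i j p) c j′ (≢dfEmbed-blade j′ j′≢j)) ⟩
      dfBladeSum (dfP c i j p) c j
        ≡⟨ dfBladeSum-own c<r j<S (pt i p) ⟩
      unitSum M (pathColour p)
        ≡⟨ colourSum-pathColour p ⟨
      colourSum (pathColour p)
        ∎
    blades hubY = sum-applyUpTo-const S _ λ j′ j′<S → dfBladeSum-own c<r j′<S hubY
    blades hubZ = sum-applyUpTo-const S _ λ j′ j′<S → dfBladeSum-own c<r j′<S hubZ

  fbVertex-sum : ∀ {t′} → t′ < t → ∀ v → vsum E f (fbEmbed t′ v) ≡ colourSum (colour (fbEmbed t′ v))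
  fbVertex-sum {t′} t′<t v = begin
    vsum E f x
      ≡⟨ vsum≡dfSum+fbSum x ⟩
    dfSum x + fbSum x
      ≡⟨ cong (_+ fbSum x) (sum-applyUpTo-zero r λ c _ → sum-applyUpTo-zero S λ j _ →
           dfBladeSum-outside x c j λ w x≡ → dfEmbed≢fbEmbed w v (sym x≡)) ⟩
    fbSum x
      ≡⟨ pairs v ⟩
    colourSum (colour x)
      ∎
    where
    open ≡-Reasoning
    x = fbEmbed t′ v
    pairs : ∀ v → fbSum (fbEmbed t′ v) ≡ colourSum (colour (fbEmbed t′ v))
    pairs (pt h p) = begin
      fbSum (fbEmbed t′ (pt h p))
        ≡⟨ sum-applyUpTo-single t t′ t′<t (λ t″ _ t″≢t′ →
             fbPairSum-outside (fbEmbed t′ (pt h p)) t″ (≢fbEmbed-pair t″ t″≢t′)) ⟩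
      fbPairSum (fbEmbed t′ (pt h p)) t′
        ≡⟨ fbPairSum-own t′<t (pt h p) ⟩
      unitSum M (pathColour p)
        ≡⟨ colourSum-pathColour p ⟨
      colourSum (pathColour p)
        ∎
    pairs apex = trans (sum-applyUpTo-const t _ λ t″ t″<t → fbPairSum-own t″<t apex) (t*[K+K]≡t*2*K t (unitSum M hub))
      where
      t*[K+K]≡t*2*K : ∀ t K → t * (K + K) ≡ t * 2 * K
      t*[K+K]≡t*2*K = solve-∀

  dfBlade-proper : ∀ c j → All (λ e → colour (dfEmbed c j (proj₁ e)) ≢ colour (dfEmbed c j (proj₂ e)))
                               (map proj₁ dfUnit)
  dfBlade-proper c j = (λ ()) ∷ (λ ()) ∷ (λ ()) ∷ (λ ()) ∷ (λ ()) ∷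
                       (λ ()) ∷ (λ ()) ∷ (λ ()) ∷ (λ ()) ∷ (λ ()) ∷ []

  fbPair-proper : ∀ t′ → All (λ e → colour (fbEmbed t′ (proj₁ e)) ≢ colour (fbEmbed t′ (proj₂ e)))
                             (map proj₁ fbUnit)
  fbPair-proper t′ = (λ ()) ∷ (λ ()) ∷ (λ ()) ∷ (λ ()) ∷ (λ ()) ∷
                     (λ ()) ∷ (λ ()) ∷ (λ ()) ∷ (λ ()) ∷ (λ ()) ∷ []

  sumsFollow : All (SumsFollow E f colour colourSum) E
  sumsFollow = All.++⁺ {xs = E₁}
    (subst (All _) (sym E₁≡) (All.concat⁺ (All.applyUpTo⁺₁ (DF S) r λ {c} c<r →
      subst (All _) (sym (DF≡ c)) (All.concat⁺ (All.applyUpTo⁺₁ (dfBlade c) S λ {j} j<S →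
        sumsFollow-image E f colour colourSum (dfEmbed c j) (dfVertex-sum c<r j<S) (map proj₁ dfUnit) (dfBlade-proper c j))))))
    (subst (All _) (sym FB≡) (All.concat⁺ (All.applyUpTo⁺₁ fbPair t λ {t′} t′<t →
      sumsFollow-image E f colour colourSum (fbEmbed t′) (fbVertex-sum t′<t) (map proj₁ fbUnit) (fbPair-proper t′))))

  colourSum-injective : 0 < t → Injective _≡_ _≡_ colourSum
  colourSum-injective t>0 = injective
    where
    end<mid : colourSum end < colourSum mid
    end<mid = s≤s (s≤s (ℕ.*-monoˡ-≤ M (ℕ.m≤m+n 8 7)))
    mid<hub : colourSum mid < colourSum hub
    mid<hub = ℕ.<-≤-trans (unitSum-mid<hub M (ℕ.≤-trans t>0 (ℕ.m≤n+m t R)))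
                          (ℕ.m≤n*m (unitSum M hub) S {{>-nonZero (ℕ.<-≤-trans t>0 (ℕ.m≤m*n t 2))}})
    injective : Injective _≡_ _≡_ colourSum
    injective {end} {end} _ = refl
    injective {mid} {mid} _ = refl
    injective {hub} {hub} _ = refl
    injective {end} {mid} e = ⊥-elim (ℕ.<⇒≢ end<mid e)
    injective {end} {hub} e = ⊥-elim (ℕ.<⇒≢ (ℕ.<-trans end<mid mid<hub) e)
    injective {mid} {hub} e = ⊥-elim (ℕ.<⇒≢ mid<hub e)
    injective {mid} {end} e = ⊥-elim (ℕ.>⇒≢ end<mid e)
    injective {hub} {end} e = ⊥-elim (ℕ.>⇒≢ (ℕ.<-trans end<mid mid<hub) e)
    injective {hub} {mid} e = ⊥-elim (ℕ.>⇒≢ mid<hub e)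

  localAntimagic : 0 < t → IsLocalAntimagic E f
  localAntimagic t>0 = sumsFollow⇒localAntimagic E f colour colourSum (colourSum-injective t>0) sumsFollow

  colours≤3 : colours E f ≤ 3
  colours≤3 = sumsFollow⇒colours≤ E f colour colourSum sumsFollow (end ∷ mid ∷ hub ∷ []) λ where
    end → here refl
    mid → there (here refl)
    hub → there (there (here refl))

DFr-colours≥3 : ∀ r s (f : Labeling (DFr r (suc s))) → IsLocalAntimagic (DFr r (suc s)) f → 3 ≤ colours (DFr r (suc s)) f
DFr-colours≥3 r s f = triangle⇒3≤colours (DFr r (suc s)) f {fbP 0 p0} {fbP 0 p1} {fbC}
  (inFB (here refl)) (inFB (there (there (here refl)))) (inFB (there (there (there (here refl)))))
  where
  inFB : ∀ {e} → e ∈ FB (suc s) → e ∈ DFr r (suc s)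
  inFB = ∈-++⁺ʳ (concatMap (DF (suc s)) (upTo r))

theorem2p8 : (r s : ℕ) → 1 ≤ r → 2 ≤ s → 2 ∣ s → χla≡ (DFr r s) 3
theorem2p8 r .(0 * 2)       _ ()  (divides zero refl)
theorem2p8 r .(suc t * 2) _ _   (divides (suc t) refl) =
  (f , localAntimagic 0<t , ℕ.≤-antisym colours≤3 (DFr-colours≥3 r (suc (t * 2)) f (localAntimagic 0<t))) ,
  DFr-colours≥3 r (suc (t * 2))
  where
  open DFrLabeling r (suc t)
  0<t : 0 < suc t
  0<t = s≤s z≤n
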